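{- Let $(a_1,\dots,a_n)$ be a finite sequence of real numbers and let $x_1,x_2,x_3,\dots$ be nonzero real numbers with $x_j\neq -x_{j-1}$ for each $j\ge2$, such that for every $l\ge1$ the sequence $(a_1,\dots,a_n,x_1,\dots,x_l)$ satisfies $\nu=0$. Then $x_2,x_3,x_4,\dots$ form an arithmetic progression with common difference $1$.
   Context: For a finite sequence $(b_1,\dots,b_N)$ of real numbers, $\nu(b_1,\dots,b_N)=\big(\sum b_i\big)^2-\sum b_i^3$. -}

module Defs where

open import Level using (Level; _⊔_; suc)
open import Algebra.Bundles using (CommutativeRing)
open import Data.List using (List; []; _∷_)
open import Data.Product using (Σ; _×_)
open import Relation.Nullary using (¬_)

record Field (c ℓ : Level) : Set (suc (c ⊔ ℓ)) where
  field
    commutativeRing : CommutativeRing c ℓ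
  open CommutativeRing commutativeRing public
  field
    1≉0     : ¬ (1# ≈ 0#)
    inverse : ∀ x → ¬ (x ≈ 0#) → Σ Carrier (λ y → (x * y ≈ 1#) × (y * x ≈ 1#))

module _ {c ℓ : Level} (R : CommutativeRing c ℓ) where
  open CommutativeRing R

  sumL : List Carrier → Carrier
  sumL []       = 0#
  sumL (b ∷ bs) = b + sumL bs

  sumCubes : List Carrier → Carrier
  sumCubes []       = 0#
  sumCubes (b ∷ bs) = b * b * b + sumCubes bs

  ν : List Carrier → Carrier
  ν bs = sumL bs * sumL bs - sumCubes bs

{-# OPTIONS --safe #-}
-- Appending y to a list with sum S and ν = 0 keeps ν = 0 iff y (2S + y) = y², so a new
-- term y ≠ 0 satisfies 2S + y = y². Writing this for consecutive terms y = x_j and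
-- z = x_{j+1} (whose prefix sum is S + y) and subtracting gives z² − y² = z + y, that is
-- (z + y) z = (z + y)(y + 1), and z + y ≠ 0 may be cancelled.
module Submission where

open import Defs
open import Level using (Level)
open import Data.Nat using (ℕ; suc)
open import Data.List using (List; _++_; applyUpTo; []; _∷_; _∷ʳ_)
open import Data.List.Properties using (applyUpTo-∷ʳ; ++-assoc)
open import Data.Product using (_,_)
open import Relation.Nullary using (¬_)
open import Relation.Binary.PropositionalEquality as ≡ using (_≡_)
open import Algebra.Bundles using (CommutativeRing)
import Algebra.Properties.Group as GroupProperties
import Algebra.Solver.Ring.NaturalCoefficients.Default as SemiringSolver
import Relation.Binary.Reasoning.Setoid as SetoidReasoning

++-applyUpTo-∷ʳ : ∀ {a} {A : Set a} (as : List A) (f : ℕ → A) n →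
                  as ++ applyUpTo f (suc n) ≡ (as ++ applyUpTo f n) ∷ʳ f n
++-applyUpTo-∷ʳ as f n = ≡.trans (≡.cong (as ++_) (≡.sym (applyUpTo-∷ʳ f n)))
                                 (≡.sym (++-assoc as (applyUpTo f n) _))

module _ {c ℓ : Level} (R : CommutativeRing c ℓ) where
  open CommutativeRing R
  open GroupProperties +-group using (x∙y⁻¹≈ε⇒x≈y; ∙-cancelˡ)
  open SemiringSolver commutativeSemiring
  open SetoidReasoning setoid

  sumL-∷ʳ : ∀ bs y → sumL R (bs ∷ʳ y) ≈ sumL R bs + y
  sumL-∷ʳ []       y = trans (+-identityʳ y) (sym (+-identityˡ y))
  sumL-∷ʳ (b ∷ bs) y = trans (+-congˡ (sumL-∷ʳ bs y)) (sym (+-assoc b (sumL R bs) y))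

  sumCubes-∷ʳ : ∀ bs y → sumCubes R (bs ∷ʳ y) ≈ sumCubes R bs + y * y * y
  sumCubes-∷ʳ []       y = trans (+-identityʳ _) (sym (+-identityˡ _))
  sumCubes-∷ʳ (b ∷ bs) y =
    trans (+-congˡ (sumCubes-∷ʳ bs y)) (sym (+-assoc _ (sumCubes R bs) _))

  ν≈0⇒sumL²≈sumCubes : ∀ bs → ν R bs ≈ 0# → sumL R bs * sumL R bs ≈ sumCubes R bs
  ν≈0⇒sumL²≈sumCubes bs = x∙y⁻¹≈ε⇒x≈y (sumL R bs * sumL R bs) (sumCubes R bs)

  ν-∷ʳ≈0⇒*-doubling : ∀ {bs y} → ν R bs ≈ 0# → ν R (bs ∷ʳ y) ≈ 0# →
           y * (sumL R bs + sumL R bs + y) ≈ y * (y * y)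
  ν-∷ʳ≈0⇒*-doubling {bs} {y} ν≈0 ν∷ʳ≈0 = ∙-cancelˡ C _ _ (begin
    C + y * (S + S + y)      ≈⟨ +-congʳ (ν≈0⇒sumL²≈sumCubes bs ν≈0) ⟨
    S * S + y * (S + S + y)  ≈⟨ solve 2 (λ S y → S :* S :+ y :* (S :+ S :+ y)
                                               := (S :+ y) :* (S :+ y)) refl S y ⟩
    (S + y) * (S + y)        ≈⟨ *-cong (sumL-∷ʳ bs y) (sumL-∷ʳ bs y) ⟨
    sumL R (bs ∷ʳ y) * sumL R (bs ∷ʳ y)  ≈⟨ ν≈0⇒sumL²≈sumCubes (bs ∷ʳ y) ν∷ʳ≈0 ⟩
    sumCubes R (bs ∷ʳ y)     ≈⟨ sumCubes-∷ʳ bs y ⟩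
    C + y * y * y            ≈⟨ +-congˡ (*-assoc y y y) ⟩
    C + y * (y * y)          ∎)
    where
    S = sumL R bs
    C = sumCubes R bs

  consecutive-doublings : ∀ {S y z} → S + S + y ≈ y * y → (S + y) + (S + y) + z ≈ z * z →
                          (z + y) * z ≈ (z + y) * (y + 1#)
  consecutive-doublings {S} {y} {z} doubling-y doubling-z = begin
    (z + y) * z                    ≈⟨ solve 2 (λ z y → (z :+ y) :* z := z :* z :+ y :* z)
                                              refl z y ⟩
    z * z + y * z                  ≈⟨ +-congʳ doubling-z ⟨
    (S + y) + (S + y) + z + y * z  ≈⟨ solve 3 (λ S y z → (S :+ y) :+ (S :+ y) :+ z :+ y :* z
                                                      := (S :+ S :+ y) :+ (y :+ z :+ y :* z))
                                              refl S y z ⟩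
    (S + S + y) + (y + z + y * z)  ≈⟨ +-congʳ doubling-y ⟩
    y * y + (y + z + y * z)        ≈⟨ solve 2 (λ z y → y :* y :+ (y :+ z :+ y :* z)
                                                    := (z :+ y) :* (y :+ con 1))
                                              refl z y ⟩
    (z + y) * (y + 1#)             ∎

module _ {c ℓ : Level} (F : Field c ℓ) where
  open Field F
  open SetoidReasoning setoid

  *-cancelˡ-≉0 : ∀ {x y z} → ¬ (x ≈ 0#) → x * y ≈ x * z → y ≈ z
  *-cancelˡ-≉0 {x} {y} {z} x≉0 xy≈xz with inverse x x≉0
  ... | x⁻¹ , _ , x⁻¹x≈1 = begin
    y              ≈⟨ *-identityˡ y ⟨
    1# * y         ≈⟨ *-congʳ x⁻¹x≈1 ⟨
    (x⁻¹ * x) * y  ≈⟨ *-assoc x⁻¹ x y ⟩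
    x⁻¹ * (x * y)  ≈⟨ *-congˡ xy≈xz ⟩
    x⁻¹ * (x * z)  ≈⟨ *-assoc x⁻¹ x z ⟨
    (x⁻¹ * x) * z  ≈⟨ *-congʳ x⁻¹x≈1 ⟩
    1# * z         ≈⟨ *-identityˡ z ⟩
    z              ∎

  ν-∷ʳ≈0⇒doubling : ∀ {bs y} → ¬ (y ≈ 0#) →
    ν commutativeRing bs ≈ 0# → ν commutativeRing (bs ∷ʳ y) ≈ 0# →
    sumL commutativeRing bs + sumL commutativeRing bs + y ≈ y * y
  ν-∷ʳ≈0⇒doubling {bs} y≉0 ν≈0 ν∷ʳ≈0 =
    *-cancelˡ-≉0 y≉0 (ν-∷ʳ≈0⇒*-doubling commutativeRing {bs} ν≈0 ν∷ʳ≈0)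

mainTheorem16 : {c ℓ : Level} (F : Field c ℓ) →
    let open Field F in
    (a : List Carrier) (x : ℕ → Carrier) →
    (∀ i → ¬ (x i ≈ 0#)) →
    (∀ i → ¬ (x (suc i) ≈ - x i)) →
    (∀ l → ν commutativeRing (a ++ applyUpTo x (suc l)) ≈ 0#) →
    ∀ i → x (suc (suc i)) ≈ x (suc i) + 1#
mainTheorem16 F a x x≉0 x≉-x ν≈0 i =
  *-cancelˡ-≉0 F z+y≉0 (consecutive-doublings R (doubling i) doubling-z)
  where
  open Field F
  open GroupProperties +-group using (inverseˡ-unique)
  R = commutativeRing
  y = x (suc i)
  z = x (suc (suc i))
  prefix : ℕ → List Carrier
  prefix l = a ++ applyUpTo x (suc l)
  doubling : ∀ l → sumL R (prefix l) + sumL R (prefix l) + x (suc l) ≈ x (suc l) * x (suc l)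
  doubling l = ν-∷ʳ≈0⇒doubling F {prefix l} (x≉0 (suc l)) (ν≈0 l)
    (≡.subst (λ bs → ν R bs ≈ 0#) (++-applyUpTo-∷ʳ a x (suc l)) (ν≈0 (suc l)))
  sumL-prefix : sumL R (prefix (suc i)) ≈ sumL R (prefix i) + y
  sumL-prefix = trans (reflexive (≡.cong (sumL R) (++-applyUpTo-∷ʳ a x (suc i))))
                      (sumL-∷ʳ R (prefix i) y)
  doubling-z : (sumL R (prefix i) + y) + (sumL R (prefix i) + y) + z ≈ z * z
  doubling-z = trans (+-congʳ (+-cong (sym sumL-prefix) (sym sumL-prefix))) (doubling (suc i))
  z+y≉0 : ¬ (z + y ≈ 0#)
  z+y≉0 z+y≈0 = x≉-x (suc i) (inverseˡ-unique z y z+y≈0)
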